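{- Let $n>1$ be an integer and let $p$ be an odd prime such that $p>\operatorname{rad}(n)$. Then for each positive integer $k$, $(1,n^{p\operatorname{ord}_p(n)k}-1,n^{p\operatorname{ord}_p(n)k})$ is an $abc$ triple. In particular, if $n\equiv 1\pmod p$ and $p>\operatorname{rad}(n)$, then $(1,n^{pk}-1,n^{pk})$ is an $abc$ triple for each positive integer $k$.
   Context: For a positive integer $n$, $\operatorname{rad}(n)$ denotes the product of the distinct prime factors of $n$. For a prime $p$ not dividing $n$, $\operatorname{ord}_p(n)$ is the least positive integer $t$ with $n^t\equiv 1\pmod p$ (here $p\nmid n$ since $p>\operatorname{rad}(n)$). An $abc$ triple is a triple $(a,b,c)$ of relatively prime positive integers with $a+b=c$ and $\operatorname{rad}(abc)<c$. -}

module Defs where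

open import Data.Nat using (ℕ; zero; suc; _+_; _*_; _∸_; _^_; _<_; _>_; _%_)
open import Data.Nat.Divisibility using (_∣_; _∣?_)
open import Data.Nat.Primality using (Prime; prime?)
open import Data.Nat.Coprimality using (Coprime)
open import Data.List using (List; filter; upTo)
open import Data.Nat.ListAction using (product)
open import Data.Product using (_×_; ∃)
open import Data.Sum using (_⊎_)
open import Relation.Nullary.Decidable using (_×-dec_)
open import Relation.Binary.PropositionalEquality using (_≡_)

primeDivisors : ℕ → List ℕ
primeDivisors n = filter (λ q → prime? q ×-dec (q ∣? n)) (upTo (suc n))

rad : ℕ → ℕ
rad n = product (primeDivisors n)

infix 4 _≡_[mod_]
_≡_[mod_] : ℕ → ℕ → ℕ → Set
a ≡ b [mod m ] = (∃ λ q → a + q * m ≡ b) ⊎ (∃ λ q → b + q * m ≡ a)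

IsOrd : ℕ → ℕ → ℕ → Set
IsOrd p n t =
  (0 < t) × (n ^ t ≡ 1 [mod p ]) ×
  (∀ s → 0 < s → n ^ s ≡ 1 [mod p ] → t Data.Nat.≤ s)

IsAbcTriple : ℕ → ℕ → ℕ → Set
IsAbcTriple a b c =
  (0 < a) × (0 < b) × (0 < c) ×
  Coprime a b × Coprime a c × Coprime b c ×
  (a + b ≡ c) × (rad (a * b * c) < c)

-- If n ^ t ≡ 1 (mod p) then the binomial theorem lifts this to n ^ (p t k) ≡ 1 (mod p²), so
-- c = n ^ (p t k) = 1 + p² M with M > 0. Every prime factor of c divides n, and every prime
-- factor of c − 1 = p² M divides p M, hence rad ((c − 1) c) ≤ rad n · p M < p · p M = c − 1.
module Submission where

open import Defs
open import Data.Nat using (ℕ; _+_; _*_; _∸_; _^_; _<_)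
open import Data.Nat.Primality using (Prime)
open import Data.Product using (_×_)
open import Relation.Binary.PropositionalEquality using (_≡_; _≢_)

open import Data.Nat using (zero; suc; _≤_; z≤n; s≤s; NonZero; >-nonZero; >-nonZero⁻¹; nonTrivial⇒≢1)
open import Data.Nat.Properties
open import Data.Nat.Divisibility
open import Data.Nat.Primality using (euclidsLemma; prime⇒irreducible; prime⇒nonZero; prime⇒nonTrivial; productOfPrimes≢0; prime?)
open import Data.Nat.Coprimality using (Coprime; 1-coprimeTo; coprime-+) renaming (sym to coprime-sym)
open import Data.Nat.ListAction using (product)
open import Data.Nat.ListAction.Properties using (∈⇒∣product)
open import Data.List using ([]; _∷_; upTo)
open import Data.List.Relation.Unary.All as All using (All; []; _∷_)
open import Data.List.Relation.Unary.All.Properties using (all-filter)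
open import Data.List.Relation.Unary.Unique.Propositional using (Unique)
open import Data.List.Relation.Unary.Unique.Propositional.Properties as Unique using ()
open import Data.List.Relation.Unary.AllPairs using ([]; _∷_)
open import Data.List.Membership.Propositional using (_∈_)
open import Data.List.Membership.Propositional.Properties using (∈-upTo⁺; ∈-filter⁺)
open import Data.List.Relation.Unary.Any using (here; there)
open import Data.Product using (∃; _,_; proj₁)
open import Data.Sum using (inj₁; inj₂)
open import Data.Empty using (⊥-elim)
open import Relation.Nullary using (¬_)
open import Relation.Nullary.Decidable using (_×-dec_)
open import Relation.Unary using (Decidable)
open import Relation.Binary.PropositionalEquality using (refl; sym; trans; cong; subst; module ≡-Reasoning)
open import Data.Nat.Solver using (module +-*-Solver)
open +-*-Solver

prime∤1 : ∀ {q} → Prime q → ¬ (q ∣ 1)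
prime∤1 pq q∣1 = nonTrivial⇒≢1 ⦃ prime⇒nonTrivial pq ⦄ (∣1⇒≡1 q∣1)

prime∣prime⇒≡ : ∀ {q r} → Prime q → Prime r → q ∣ r → q ≡ r
prime∣prime⇒≡ pq pr q∣r with prime⇒irreducible pr q∣r
... | inj₁ q≡1 = ⊥-elim (nonTrivial⇒≢1 ⦃ prime⇒nonTrivial pq ⦄ q≡1)
... | inj₂ q≡r = q≡r

prime∣^⇒prime∣ : ∀ {q} n e → Prime q → q ∣ n ^ e → q ∣ n
prime∣^⇒prime∣ n zero    pq q∣1 = ⊥-elim (prime∤1 pq q∣1)
prime∣^⇒prime∣ n (suc e) pq q∣n*nᵉ with euclidsLemma n (n ^ e) pq q∣n*nᵉ
... | inj₁ q∣n  = q∣n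
... | inj₂ q∣nᵉ = prime∣^⇒prime∣ n e pq q∣nᵉ

prime∣product⇒∈ : ∀ {q} qs → Prime q → All Prime qs → q ∣ product qs → q ∈ qs
prime∣product⇒∈ []       pq []         q∣1 = ⊥-elim (prime∤1 pq q∣1)
prime∣product⇒∈ (r ∷ qs) pq (pr ∷ pqs) q∣r*P with euclidsLemma r (product qs) pq q∣r*P
... | inj₁ q∣r = here (prime∣prime⇒≡ pq pr q∣r)
... | inj₂ q∣P = there (prime∣product⇒∈ qs pq pqs q∣P)

-- q cannot divide the cofactor s, since q ∤ product qs by uniqueness.
product-∣ : ∀ {R} qs → Unique qs → All Prime qs → All (_∣ R) qs → product qs ∣ R
product-∣ []       _              _          _            = 1∣ _
product-∣ (q ∷ qs) (q∉qs ∷ uniq) (pq ∷ pqs) (q∣R ∷ qs∣R) with product-∣ qs uniq pqs qs∣R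
... | divides s R≡s*P with euclidsLemma s (product qs) pq (subst (q ∣_) R≡s*P q∣R)
...   | inj₂ q∣P = ⊥-elim (All.lookup q∉qs (prime∣product⇒∈ qs pq pqs q∣P) refl)
...   | inj₁ (divides v s≡v*q) = divides v (begin
  _                      ≡⟨ R≡s*P ⟩
  s * product qs         ≡⟨ cong (_* product qs) s≡v*q ⟩
  v * q * product qs     ≡⟨ *-assoc v q (product qs) ⟩
  v * (q * product qs)   ∎)
  where open ≡-Reasoning

isPrimeDivisor? : ∀ n → Decidable (λ q → Prime q × q ∣ n)
isPrimeDivisor? n q = prime? q ×-dec (q ∣? n)

primeDivisors-sound : ∀ n → All (λ q → Prime q × q ∣ n) (primeDivisors n)
primeDivisors-sound n = all-filter (isPrimeDivisor? n) (upTo (suc n))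

rad≢0 : ∀ n → NonZero (rad n)
rad≢0 n = productOfPrimes≢0 (All.map proj₁ (primeDivisors-sound n))

prime∣⇒∣rad : ∀ {q n} → .⦃ NonZero n ⦄ → Prime q → q ∣ n → q ∣ rad n
prime∣⇒∣rad {q} {n} pq q∣n =
  ∈⇒∣product (∈-filter⁺ (isPrimeDivisor? n) (∈-upTo⁺ (s≤s (∣⇒≤ q∣n))) (pq , q∣n))

rad-∣ : ∀ N R → (∀ q → Prime q → q ∣ N → q ∣ R) → rad N ∣ R
rad-∣ N R primes∣R = product-∣ (primeDivisors N)
  (Unique.filter⁺ (isPrimeDivisor? N) (Unique.upTo⁺ (suc N)))
  (All.map proj₁ (primeDivisors-sound N))
  (All.map (λ (pq , q∣N) → primes∣R _ pq q∣N) (primeDivisors-sound N))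

1+x^m-expansion : ∀ x m → ∃ λ w → (1 + x) ^ m ≡ 1 + x * (m + x * w)
1+x^m-expansion x zero = 0 , solve 1 (λ x → con 1 := con 1 :+ x :* (con 0 :+ x :* con 0)) refl x
1+x^m-expansion x (suc m) with 1+x^m-expansion x m
... | w , eq = w + m + x * w , trans (cong ((1 + x) *_) eq)
  (solve 3 (λ x m w → (con 1 :+ x) :* (con 1 :+ x :* (m :+ x :* w))
     := con 1 :+ x :* ((con 1 :+ m) :+ x :* (w :+ m :+ x :* w))) refl x m w)

1+x^m≡1+x*y : ∀ x m → ∃ λ y → (1 + x) ^ m ≡ 1 + x * y
1+x^m≡1+x*y x m with 1+x^m-expansion x m
... | w , eq = m + x * w , eq

-- (1 + q p) ^ p = 1 + q p (p + q p w): the middle binomial coefficient p supplies the second p.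
1+qp^p≡1+p²r : ∀ q p → ∃ λ r → (1 + q * p) ^ p ≡ 1 + p * p * r
1+qp^p≡1+p²r q p with 1+x^m-expansion (q * p) p
... | w , eq = q + q * q * w , trans eq (cong suc
  (solve 3 (λ q p w → (q :* p) :* (p :+ (q :* p) :* w) := p :* p :* (q :+ q :* q :* w)) refl q p w))

1+qp^pk≡1+p²M : ∀ q p k → ∃ λ M → (1 + q * p) ^ (p * k) ≡ 1 + p * p * M
1+qp^pk≡1+p²M q p k with 1+qp^p≡1+p²r q p
... | r , eqʳ with 1+x^m≡1+x*y (p * p * r) k
...   | y , eqʸ = r * y , (begin
  (1 + q * p) ^ (p * k)     ≡⟨ ^-*-assoc (1 + q * p) p k ⟨
  ((1 + q * p) ^ p) ^ k     ≡⟨ cong (_^ k) eqʳ ⟩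
  (1 + p * p * r) ^ k       ≡⟨ eqʸ ⟩
  1 + p * p * r * y         ≡⟨ cong suc (*-assoc (p * p) r y) ⟩
  1 + p * p * (r * y)       ∎)
  where open ≡-Reasoning

≡1[mod]⇒≡1+* : ∀ {a p} → 1 < a → a ≡ 1 [mod p ] → ∃ λ q → a ≡ 1 + q * p
≡1[mod]⇒≡1+* {a} 1<a (inj₁ (q , a+qp≡1)) = ⊥-elim (<⇒≱ 1<a (subst (a ≤_) a+qp≡1 (m≤m+n a _)))
≡1[mod]⇒≡1+* _   (inj₂ (q , 1+qp≡a)) = q , sym 1+qp≡a

isAbcTriple-1,X,1+X : ∀ X → 0 < X → rad (1 * X * suc X) < suc X → IsAbcTriple 1 X (suc X)
isAbcTriple-1,X,1+X X X>0 rad<c =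
  s≤s z≤n , X>0 , s≤s z≤n , 1-coprimeTo X , 1-coprimeTo (suc X) , X⊥1+X , refl , rad<c
  where
  X⊥1+X : Coprime X (suc X)
  X⊥1+X = coprime-sym (subst (λ c → Coprime c X) (+-comm X 1) (coprime-+ (1-coprimeTo X)))

-- rad (c − 1) c ∣ rad n · p M, which is below p · p M; this is where rad n < p enters.
rad[p²M*[1+p²M]]<1+p²M : ∀ {n p} M → .⦃ NonZero n ⦄ → .⦃ NonZero M ⦄ → Prime p → rad n < p →
  (∀ q → Prime q → q ∣ suc (p * p * M) → q ∣ n) →
  rad (1 * (p * p * M) * suc (p * p * M)) < suc (p * p * M)
rad[p²M*[1+p²M]]<1+p²M {n} {p} M pp rad<p c-primes∣n = ≤-<-trans
  (∣⇒≤ ⦃ m*n≢0 (rad n) (p * M) ⦃ rad≢0 n ⦄ ⦄ (rad-∣ _ (rad n * (p * M)) primes∣radn*pM))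
  (m<n⇒m<1+n (subst (rad n * (p * M) <_) (sym (*-assoc p p M)) (*-monoˡ-< (p * M) rad<p)))
  where
  instance
    _ : NonZero (p * M)
    _ = m*n≢0 p M ⦃ prime⇒nonZero pp ⦄
  primes∣radn*pM : ∀ q → Prime q → q ∣ 1 * (p * p * M) * suc (p * p * M) → q ∣ rad n * (p * M)
  primes∣radn*pM q pq q∣ with euclidsLemma (1 * (p * p * M)) (suc (p * p * M)) pq q∣
  ... | inj₂ q∣c = ∣m⇒∣m*n (p * M) (prime∣⇒∣rad pq (c-primes∣n q pq q∣c))
  ... | inj₁ q∣c-1 with euclidsLemma (p * p) M pq (subst (q ∣_) (*-identityˡ _) q∣c-1)
  ...   | inj₂ q∣M = ∣n⇒∣m*n (rad n) (∣n⇒∣m*n p q∣M)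
  ...   | inj₁ q∣p*p with euclidsLemma p p pq q∣p*p
  ...     | inj₁ q∣p = ∣n⇒∣m*n (rad n) (∣m⇒∣m*n M q∣p)
  ...     | inj₂ q∣p = ∣n⇒∣m*n (rad n) (∣m⇒∣m*n M q∣p)

abcTriple-n^e≡1+p²M : ∀ {n p e} M → 1 < n → 0 < e → Prime p → rad n < p →
  n ^ e ≡ 1 + p * p * M → IsAbcTriple 1 (n ^ e ∸ 1) (n ^ e)
abcTriple-n^e≡1+p²M {n} {p} {e} zero 1<n e>0 _ _ nᵉ≡1+p²*0 =
  ⊥-elim (<-irrefl (sym (trans nᵉ≡1+p²*0 (cong suc (*-zeroʳ (p * p))))) (^-monoʳ-< n 1<n e>0))
abcTriple-n^e≡1+p²M {n} {p} {e} M@(suc _) 1<n e>0 pp rad<p nᵉ≡1+p²M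
  rewrite nᵉ≡1+p²M = isAbcTriple-1,X,1+X (p * p * M) (>-nonZero⁻¹ _ ⦃ p*p*M≢0 ⦄)
    (rad[p²M*[1+p²M]]<1+p²M M ⦃ >-nonZero (<-trans (s≤s z≤n) 1<n) ⦄ pp rad<p c-primes∣n)
  where
  p*p*M≢0 : NonZero (p * p * M)
  p*p*M≢0 = m*n≢0 (p * p) M ⦃ m*n≢0 p p ⦃ prime⇒nonZero pp ⦄ ⦃ prime⇒nonZero pp ⦄ ⦄
  c-primes∣n : ∀ q → Prime q → q ∣ suc (p * p * M) → q ∣ n
  c-primes∣n q pq q∣c = prime∣^⇒prime∣ n e pq (subst (q ∣_) (sym nᵉ≡1+p²M) q∣c)

corollary3p6 : (n p : ℕ) → 1 < n → Prime p → p ≢ 2 → rad n < p →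
    ((t : ℕ) → IsOrd p n t → (k : ℕ) → 0 < k →
      IsAbcTriple 1 (n ^ (p * t * k) ∸ 1) (n ^ (p * t * k)))
    × (n ≡ 1 [mod p ] → (k : ℕ) → 0 < k →
      IsAbcTriple 1 (n ^ (p * k) ∸ 1) (n ^ (p * k)))
corollary3p6 n p 1<n pp _ rad<p = order-case , ≡1-case
  where
  p≢0 : NonZero p
  p≢0 = prime⇒nonZero pp
  order-case : (t : ℕ) → IsOrd p n t → (k : ℕ) → 0 < k →
    IsAbcTriple 1 (n ^ (p * t * k) ∸ 1) (n ^ (p * t * k))
  order-case t (t>0 , nᵗ≡1 , _) k k>0 with ≡1[mod]⇒≡1+* (^-monoʳ-< n 1<n t>0) nᵗ≡1
  ... | q , nᵗ≡1+qp with 1+qp^pk≡1+p²M q p k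
  ...   | M , eq = abcTriple-n^e≡1+p²M M 1<n ptk>0 pp rad<p (begin
    n ^ (p * t * k)       ≡⟨ cong (n ^_) (solve 3 (λ p t k → p :* t :* k := t :* (p :* k)) refl p t k) ⟩
    n ^ (t * (p * k))     ≡⟨ ^-*-assoc n t (p * k) ⟨
    (n ^ t) ^ (p * k)     ≡⟨ cong (_^ (p * k)) nᵗ≡1+qp ⟩
    (1 + q * p) ^ (p * k) ≡⟨ eq ⟩
    1 + p * p * M         ∎)
    where
    open ≡-Reasoning
    ptk>0 : 0 < p * t * k
    ptk>0 = >-nonZero⁻¹ _ ⦃ m*n≢0 (p * t) k ⦃ m*n≢0 p t ⦃ p≢0 ⦄ ⦃ >-nonZero t>0 ⦄ ⦄ ⦃ >-nonZero k>0 ⦄ ⦄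
  ≡1-case : n ≡ 1 [mod p ] → (k : ℕ) → 0 < k → IsAbcTriple 1 (n ^ (p * k) ∸ 1) (n ^ (p * k))
  ≡1-case n≡1 k k>0 with ≡1[mod]⇒≡1+* 1<n n≡1
  ... | q , n≡1+qp with 1+qp^pk≡1+p²M q p k
  ...   | M , eq = abcTriple-n^e≡1+p²M M 1<n (>-nonZero⁻¹ _ ⦃ m*n≢0 p k ⦃ p≢0 ⦄ ⦃ >-nonZero k>0 ⦄ ⦄)
                     pp rad<p (trans (cong (_^ (p * k)) n≡1+qp) eq)
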